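{- (1) Suppose $\langle B,f\rangle\in\mathsf{GMA}$ with respect to $a$, where $a\notin\{0,1\}$. Then $R_f$ has two levels: there is a partition of $\mathrm{Ult}(B)$ into nonempty sets $U$ (lower level) and $V$ (upper level) such that $R_f=(U\times V)\cup 1'$. (2) If $\langle W,R\rangle$ is a frame where $W$ is partitioned into two nonempty sets (levels) $U,V$ and $R=(U\times V)\cup 1'$, then there is $b\subseteq W$ such that for all $Y\subseteq W$, $\langle R\rangle(Y)=Y$ if $Y\subseteq b$ and $\langle R\rangle(Y)=b\cup Y$ otherwise.
   Context: $B$ is a Boolean algebra, $\mathrm{Ult}(B)$ its set of ultrafilters, $1'$ the identity relation. $\langle B,f\rangle\in\mathsf{GMA}$ with respect to $a$ means $f(x)=x$ if $x\le a$ and $f(x)=a+x$ if $x\not\le a$. The canonical relation is $u\,R_f\,v$ iff $f[v]\subseteq u$ for $u,v\in\mathrm{Ult}(B)$. For a frame $\langle W,R\rangle$, $\langle R\rangle(X)=\{x\in W: R(x)\cap X\neq\emptyset\}$ with $R(x)=\{y: xRy\}$. -}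

module Defs where

open import Level using (Level; _⊔_; suc)
open import Data.Product using (Σ; _×_; _,_; proj₁)
open import Data.Sum using (_⊎_)
open import Relation.Nullary using (¬_)
open import Relation.Unary using (Pred)
open import Algebra.Lattice.Bundles using (BooleanAlgebra)

module _ {c ℓ : Level} (B : BooleanAlgebra c ℓ) where
  open BooleanAlgebra B renaming (¬_ to ∁_)

  _≤ᴮ_ : Carrier → Carrier → Set ℓ
  x ≤ᴮ y = x ∧ y ≈ x

  IsGMA : (Carrier → Carrier) → Carrier → Set (c ⊔ ℓ)
  IsGMA f a = (∀ x → x ≤ᴮ a → f x ≈ x) × (∀ x → ¬ (x ≤ᴮ a) → f x ≈ a ∨ x)

  record IsUltrafilter {p : Level} (F : Pred Carrier p) : Set (c ⊔ ℓ ⊔ p) where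
    field
      top       : F ⊤
      proper    : ¬ F ⊥
      up-closed : ∀ {x y} → x ≤ᴮ y → F x → F y
      ∧-closed  : ∀ {x y} → F x → F y → F (x ∧ y)
      ultra     : ∀ x → F x ⊎ F (∁ x)

  Ult : (p : Level) → Set (c ⊔ ℓ ⊔ suc p)
  Ult p = Σ (Pred Carrier p) IsUltrafilter

  _∈ᵁ_ : ∀ {p} → Carrier → Ult p → Set p
  x ∈ᵁ u = proj₁ u x

  -- identity relation 1' on Ult(B): equality of ultrafilters as sets
  _≐ᵁ_ : ∀ {p} → Ult p → Ult p → Set (c ⊔ p)
  u ≐ᵁ v = ∀ x → (x ∈ᵁ u → x ∈ᵁ v) × (x ∈ᵁ v → x ∈ᵁ u)

  Rcan : ∀ {p} → (Carrier → Carrier) → Ult p → Ult p → Set (c ⊔ p)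
  Rcan f u v = ∀ x → x ∈ᵁ v → f x ∈ᵁ u

  UltrafilterLemma : (p : Level) → Set (c ⊔ ℓ ⊔ suc p)
  UltrafilterLemma p = ∀ x → ¬ (x ≈ ⊥) → Σ (Ult p) (λ u → x ∈ᵁ u)

⟨_⟩◇ : ∀ {a r q} {W : Set a} → (W → W → Set r) → Pred W q → Pred W (a ⊔ r ⊔ q)
⟨_⟩◇ {W = W} R X x = Σ W (λ y → R x y × X y)

{-# OPTIONS --safe #-}
-- (1) An ultrafilter u either contains a (u is in the lower level) or ∁ a (upper level). If
-- ∁ a ∈ u then every x ∈ u satisfies x ≰ a, so f x ≈ a ∨ x; together with f x ≈ x below a this
-- makes f inflationary on ultrafilters, puts every lower ultrafilter R_f-below every upper one,
-- and forces R_f-related ultrafilters on the same level (or with an upper target) to coincide.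
-- Both levels are nonempty by the ultrafilter lemma, since neither a nor ∁ a is ⊥.
-- (2) Take b to be the lower level U. Reflexivity gives Y ⊆ ⟨R⟩Y, and ⟨R⟩Y ⊆ U ∪ Y since every
-- non-identity edge starts in U. When Y ⊆ U no edge enters Y from outside; otherwise Y meets V
-- (excluded middle), and any point of Y ∩ V is an R-successor of every point of U.
module Submission where

open import Defs
open import Level using (Level)
open import Data.Product using (Σ; _×_; _,_; proj₁; proj₂)
open import Data.Sum using (_⊎_; inj₁; inj₂; fromInj₁; fromInj₂)
open import Data.Empty using (⊥-elim)
open import Relation.Nullary using (¬_; yes; no)
open import Relation.Unary using (Pred; _⊆_; _∪_)
open import Relation.Binary.PropositionalEquality using (_≡_; refl)
open import Algebra.Lattice.Bundles using (BooleanAlgebra)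
open import Axiom.ExcludedMiddle using (ExcludedMiddle)
import Algebra.Lattice.Properties.BooleanAlgebra as BooleanAlgebraProperties
import Relation.Binary.Reasoning.Setoid as SetoidReasoning

private
  variable
    p : Level

module BooleanAlgebraFacts {c ℓ} (B : BooleanAlgebra c ℓ) where
  open BooleanAlgebra B renaming (¬_ to ∁_)
  open BooleanAlgebraProperties B
  open SetoidReasoning setoid

  x∧y≤x : ∀ x y → _≤ᴮ_ B (x ∧ y) x
  x∧y≤x x y = begin
    (x ∧ y) ∧ x  ≈⟨ ∧-comm _ _ ⟩
    x ∧ (x ∧ y)  ≈⟨ sym (∧-assoc _ _ _) ⟩
    (x ∧ x) ∧ y  ≈⟨ ∧-congʳ (∧-idem x) ⟩
    x ∧ y        ∎

  x∧y≤y : ∀ x y → _≤ᴮ_ B (x ∧ y) y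
  x∧y≤y x y = begin
    (x ∧ y) ∧ y  ≈⟨ ∧-assoc _ _ _ ⟩
    x ∧ (y ∧ y)  ≈⟨ ∧-congˡ (∧-idem y) ⟩
    x ∧ y        ∎

  x≤x∨y : ∀ x y → _≤ᴮ_ B x (x ∨ y)
  x≤x∨y = ∧-absorbs-∨

  y≤x∨y : ∀ x y → _≤ᴮ_ B y (x ∨ y)
  y≤x∨y x y = trans (∧-congˡ (∨-comm x y)) (∧-absorbs-∨ y x)

  x≉⊤⇒∁x≉⊥ : ∀ {x} → ¬ x ≈ ⊤ → ¬ ∁ x ≈ ⊥
  x≉⊤⇒∁x≉⊥ {x} x≉⊤ ∁x≈⊥ = x≉⊤ (begin
    x        ≈⟨ sym (¬-involutive x) ⟩
    ∁ (∁ x)  ≈⟨ ¬-cong ∁x≈⊥ ⟩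
    ∁ ⊥      ≈⟨ ¬⊥≈⊤ ⟩
    ⊤        ∎)

module UltrafilterFacts {c ℓ} (B : BooleanAlgebra c ℓ) where
  open BooleanAlgebra B renaming (¬_ to ∁_)
  open BooleanAlgebraProperties B using (deMorgan₂; ∧-idem)

  infix 4 _∈_
  _∈_ : Carrier → Ult B p → Set p
  x ∈ u = _∈ᵁ_ B x u

  module _ (u : Ult B p) where
    open IsUltrafilter (proj₂ u)

    ∈-resp-≈ : ∀ {x y} → x ≈ y → x ∈ u → y ∈ u
    ∈-resp-≈ {x} x≈y = up-closed (trans (∧-congˡ (sym x≈y)) (∧-idem x))

    ∁∈⇒∉ : ∀ {x} → ∁ x ∈ u → ¬ x ∈ u
    ∁∈⇒∉ ∁x∈u x∈u = proper (∈-resp-≈ (∧-complementʳ _) (∧-closed x∈u ∁x∈u))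

    ∈-stable : ∀ {x} → ¬ ¬ x ∈ u → x ∈ u
    ∈-stable {x} ¬¬x∈u with ultra x
    ... | inj₁ x∈u  = x∈u
    ... | inj₂ ∁x∈u = ⊥-elim (¬¬x∈u (∁∈⇒∉ ∁x∈u))

    ∈-∨⁻ : ∀ {x y} → (x ∨ y) ∈ u → x ∈ u ⊎ y ∈ u
    ∈-∨⁻ {x} {y} x∨y∈u with ultra x | ultra y
    ... | inj₁ x∈u  | _         = inj₁ x∈u
    ... | inj₂ _    | inj₁ y∈u  = inj₂ y∈u
    ... | inj₂ ∁x∈u | inj₂ ∁y∈u =
      ⊥-elim (∁∈⇒∉ (∈-resp-≈ (sym (deMorgan₂ x y)) (∧-closed ∁x∈u ∁y∈u)) x∨y∈u)

  ⊇⇒≐ᵁ : ∀ (u v : Ult B p) → (∀ x → x ∈ v → x ∈ u) → _≐ᵁ_ B u v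
  ⊇⇒≐ᵁ u v v⊆u x = u⊆v , v⊆u x
    where
    u⊆v : x ∈ u → x ∈ v
    u⊆v x∈u with IsUltrafilter.ultra (proj₂ v) x
    ... | inj₁ x∈v  = x∈v
    ... | inj₂ ∁x∈v = ⊥-elim (∁∈⇒∉ u (v⊆u _ ∁x∈v) x∈u)

module GMA {c ℓ} (B : BooleanAlgebra c ℓ)
  (f : BooleanAlgebra.Carrier B → BooleanAlgebra.Carrier B) (a : BooleanAlgebra.Carrier B)
  (gma : IsGMA B f a) where
  open BooleanAlgebra B renaming (¬_ to ∁_)
  open BooleanAlgebraFacts B
  open UltrafilterFacts B

  private
    f-below : ∀ x → _≤ᴮ_ B x a → f x ≈ x
    f-below = proj₁ gma

    f-not-below : ∀ x → ¬ _≤ᴮ_ B x a → f x ≈ a ∨ x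
    f-not-below = proj₂ gma

  Lower Upper : Pred (Ult B p) p
  Lower u = a ∈ u
  Upper u = ∁ a ∈ u

  f-preserves-∈ : ∀ (u : Ult B p) {x} → x ∈ u → f x ∈ u
  f-preserves-∈ u {x} x∈u = ∈-stable u λ fx∉u →
    let x≰a = λ x≤a → fx∉u (∈-resp-≈ u (sym (f-below x x≤a)) x∈u)
    in fx∉u (∈-resp-≈ u (sym (f-not-below x x≰a)) (up-closed (y≤x∨y a x) x∈u))
    where open IsUltrafilter (proj₂ u)

  ∈-upper⇒≰ : ∀ (v : Ult B p) {x} → Upper v → x ∈ v → ¬ _≤ᴮ_ B x a
  ∈-upper⇒≰ v ∁a∈v x∈v x≤a = ∁∈⇒∉ v ∁a∈v (IsUltrafilter.up-closed (proj₂ v) x≤a x∈v)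

  Rcan-lower-upper : ∀ (u v : Ult B p) → Lower u → Upper v → Rcan B f u v
  Rcan-lower-upper u v a∈u ∁a∈v x x∈v =
    ∈-resp-≈ u (sym (f-not-below x (∈-upper⇒≰ v ∁a∈v x∈v)))
      (IsUltrafilter.up-closed (proj₂ u) (x≤x∨y a x) a∈u)

  ≐ᵁ⇒Rcan : ∀ (u v : Ult B p) → _≐ᵁ_ B u v → Rcan B f u v
  ≐ᵁ⇒Rcan u v u≐v x x∈v = f-preserves-∈ u (proj₂ (u≐v x) x∈v)

  -- Meeting with a pushes x under a, where f is the identity.
  Rcan-to-lower⇒≐ᵁ : ∀ (u v : Ult B p) → Lower v → Rcan B f u v → _≐ᵁ_ B u v
  Rcan-to-lower⇒≐ᵁ u v a∈v uRv = ⊇⇒≐ᵁ u v λ x x∈v →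
    let x∧a∈v = IsUltrafilter.∧-closed (proj₂ v) x∈v a∈v
        x∧a∈u = ∈-resp-≈ u (f-below (x ∧ a) (x∧y≤y x a)) (uRv _ x∧a∈v)
    in IsUltrafilter.up-closed (proj₂ u) (x∧y≤x x a) x∧a∈u

  Rcan-upper-upper⇒≐ᵁ : ∀ (u v : Ult B p) → Upper u → Upper v → Rcan B f u v → _≐ᵁ_ B u v
  Rcan-upper-upper⇒≐ᵁ u v ∁a∈u ∁a∈v uRv = ⊇⇒≐ᵁ u v λ x x∈v →
    let a∨x∈u = ∈-resp-≈ u (f-not-below x (∈-upper⇒≰ v ∁a∈v x∈v)) (uRv x x∈v)
    in fromInj₂ (λ a∈u → ⊥-elim (∁∈⇒∉ u ∁a∈u a∈u)) (∈-∨⁻ u a∨x∈u)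

  Rcan⇒two-level : ∀ (u v : Ult B p) → Rcan B f u v → (Lower u × Upper v) ⊎ _≐ᵁ_ B u v
  Rcan⇒two-level u v uRv with IsUltrafilter.ultra (proj₂ v) a | IsUltrafilter.ultra (proj₂ u) a
  ... | inj₁ a∈v  | _         = inj₂ (Rcan-to-lower⇒≐ᵁ u v a∈v uRv)
  ... | inj₂ ∁a∈v | inj₁ a∈u  = inj₁ (a∈u , ∁a∈v)
  ... | inj₂ ∁a∈v | inj₂ ∁a∈u = inj₂ (Rcan-upper-upper⇒≐ᵁ u v ∁a∈u ∁a∈v uRv)

  two-level⇒Rcan : ∀ (u v : Ult B p) → (Lower u × Upper v) ⊎ _≐ᵁ_ B u v → Rcan B f u v
  two-level⇒Rcan u v (inj₁ (a∈u , ∁a∈v)) = Rcan-lower-upper u v a∈u ∁a∈v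
  two-level⇒Rcan u v (inj₂ u≐v)         = ≐ᵁ⇒Rcan u v u≐v

  levels-cover : ∀ (u : Ult B p) → Lower u ⊎ Upper u
  levels-cover u = IsUltrafilter.ultra (proj₂ u) a

  levels-disjoint : ∀ (u : Ult B p) → ¬ (Lower u × Upper u)
  levels-disjoint u (a∈u , ∁a∈u) = ∁∈⇒∉ u ∁a∈u a∈u

  lower-nonempty : UltrafilterLemma B p → ¬ a ≈ ⊥ → Σ (Ult B p) Lower
  lower-nonempty ufl a≉⊥ = ufl a a≉⊥

  upper-nonempty : UltrafilterLemma B p → ¬ a ≈ ⊤ → Σ (Ult B p) Upper
  upper-nonempty ufl a≉⊤ = ufl (∁ a) (x≉⊤⇒∁x≉⊥ a≉⊤)

module TwoLevelFrame {w r ℓ} {W : Set w} (R : W → W → Set r) (U V : Pred W ℓ)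
  (R-two-level : ∀ x y → (R x y → (U x × V y) ⊎ x ≡ y) × ((U x × V y) ⊎ x ≡ y → R x y)) where

  R-refl : ∀ x → R x x
  R-refl x = proj₂ (R-two-level x x) (inj₂ refl)

  module _ {q} (Y : Pred W q) where

    ⊆-◇ : Y ⊆ ⟨ R ⟩◇ Y
    ⊆-◇ {x} Yx = x , R-refl x , Yx

    ◇-⊆-U∪ : ⟨ R ⟩◇ Y ⊆ (U ∪ Y)
    ◇-⊆-U∪ {x} (y , xRy , Yy) with proj₁ (R-two-level x y) xRy
    ... | inj₁ (Ux , _) = inj₁ Ux
    ... | inj₂ refl     = inj₂ Yy

    ◇-⊆-of-⊆U : (∀ x → ¬ (U x × V x)) → Y ⊆ U → ⟨ R ⟩◇ Y ⊆ Y
    ◇-⊆-of-⊆U disjoint Y⊆U {x} (y , xRy , Yy) with proj₁ (R-two-level x y) xRy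
    ... | inj₁ (_ , Vy) = ⊥-elim (disjoint y (Y⊆U Yy , Vy))
    ... | inj₂ refl     = Yy

    U∪-⊆-◇ : Σ W (λ y → Y y × V y) → (U ∪ Y) ⊆ ⟨ R ⟩◇ Y
    U∪-⊆-◇ (y , Yy , Vy) {x} (inj₁ Ux) = y , proj₂ (R-two-level x y) (inj₁ (Ux , Vy)) , Yy
    U∪-⊆-◇ _             (inj₂ Yx) = ⊆-◇ Yx

⊈-lower⇒meets-upper : ∀ {w} → ExcludedMiddle w → {W : Set w} (U V Y : Pred W w) →
  (∀ x → U x ⊎ V x) → ¬ (Y ⊆ U) → Σ W (λ y → Y y × V y)
⊈-lower⇒meets-upper em U V Y cover Y⊈U with em
... | yes meets = meets
... | no misses = ⊥-elim (Y⊈U λ {x} Yx → fromInj₁ (λ Vx → ⊥-elim (misses (x , Yx , Vx))) (cover x))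

theorem6p14 : ∀ {c ℓ p w} →
    -- (1)
    ((B : BooleanAlgebra c ℓ) → UltrafilterLemma B p →
      (f : BooleanAlgebra.Carrier B → BooleanAlgebra.Carrier B) (a : BooleanAlgebra.Carrier B) →
      IsGMA B f a →
      ¬ (BooleanAlgebra._≈_ B a (BooleanAlgebra.⊥ B)) → ¬ (BooleanAlgebra._≈_ B a (BooleanAlgebra.⊤ B)) →
      Σ (Pred (Ult B p) p) λ U → Σ (Pred (Ult B p) p) λ V →
        (∀ u → U u ⊎ V u) × (∀ u → ¬ (U u × V u)) ×
        Σ (Ult B p) U × Σ (Ult B p) V ×
        (∀ u v → (Rcan B f u v → (U u × V v) ⊎ _≐ᵁ_ B u v)
               × ((U u × V v) ⊎ _≐ᵁ_ B u v → Rcan B f u v)))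
    ×
    -- (2)
    (ExcludedMiddle w →
      (W : Set w) (R : W → W → Set w) (U V : Pred W w) →
      (∀ x → U x ⊎ V x) → (∀ x → ¬ (U x × V x)) → Σ W U → Σ W V →
      (∀ x y → (R x y → (U x × V y) ⊎ x ≡ y) × ((U x × V y) ⊎ x ≡ y → R x y)) →
      Σ (Pred W w) λ b → (Y : Pred W w) →
        (Y ⊆ b → (⟨ R ⟩◇ Y ⊆ Y) × (Y ⊆ ⟨ R ⟩◇ Y))
        × (¬ (Y ⊆ b) → (⟨ R ⟩◇ Y ⊆ (b ∪ Y)) × ((b ∪ Y) ⊆ ⟨ R ⟩◇ Y)))
theorem6p14 =
  (λ B ufl f a gma a≉⊥ a≉⊤ → let open GMA B f a gma in
    Lower , Upper , levels-cover , levels-disjoint ,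
    lower-nonempty ufl a≉⊥ , upper-nonempty ufl a≉⊤ ,
    λ u v → Rcan⇒two-level u v , two-level⇒Rcan u v) ,
  (λ em W R U V cover disjoint _ _ R-two-level → let open TwoLevelFrame R U V R-two-level in
    U , λ Y →
      (λ Y⊆U → ◇-⊆-of-⊆U Y disjoint Y⊆U , ⊆-◇ Y) ,
      (λ Y⊈U → ◇-⊆-U∪ Y , U∪-⊆-◇ Y (⊈-lower⇒meets-upper em U V Y cover Y⊈U)))
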